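{- Let $a\ge 2$ be an integer and $T=T(a,a+1,a+2)$. Then the line graph $L(T)$ is transmission irregular if and only if $a$ is even.
   Context: The transmission of a vertex $v$ of a graph $G$ is ${\rm Tr}_G(v)=\sum_{u\in V(G)} d_G(u,v)$; $G$ is transmission irregular if all its vertices have pairwise different transmissions. The starlike tree $T(k_1,k_2,k_3)$ is the tree obtained by attaching to a single vertex three pendant paths of lengths $k_1,k_2,k_3$. $L(G)$ denotes the line graph of $G$. -}

module Defs where

open import Data.Nat using (ℕ; zero; suc; _+_)
open import Data.Bool using (Bool; true; false; _∧_; _∨_; not; if_then_else_)
open import Data.Fin using (Fin)
open import Data.Fin.Properties using () renaming (_≟_ to _≟ᶠ_)
open import Data.Nat.Properties using () renaming (_≟_ to _≟ⁿ_)
open import Data.List using (List; []; _∷_; _++_; length; lookup; map; allFin)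
open import Data.Bool.ListAction using (any)
open import Data.Nat.ListAction using (sum)
open import Data.Product using (_×_; _,_)
open import Relation.Nullary.Decidable using (⌊_⌋)
open import Relation.Binary.PropositionalEquality using (_≡_)

record Graph : Set where
  field
    n   : ℕ
    adj : Fin n → Fin n → Bool
open Graph public

reach : (G : Graph) → ℕ → Fin (n G) → Fin (n G) → Bool
reach G zero    u v = ⌊ u ≟ᶠ v ⌋
reach G (suc k) u v =
  reach G k u v ∨ any (λ w → reach G k u w ∧ adj G w v) (allFin (n G))

-- least j ≥ k (searching at most `fuel` further steps) with p j; returns
-- k + fuel if none is found.
least : (ℕ → Bool) → ℕ → ℕ → ℕ
least p k zero       = k
least p k (suc fuel) = if p k then k else least p (suc k) fuel

-- Graph distance d_G(u,v): the least k with a walk of length k from u to v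
-- (search bounded by n, which suffices for connected graphs).
dist : (G : Graph) → Fin (n G) → Fin (n G) → ℕ
dist G u v = least (λ k → reach G k u v) 0 (n G)

Tr : (G : Graph) → Fin (n G) → ℕ
Tr G v = sum (map (λ u → dist G u v) (allFin (n G)))

TransmissionIrregular : Graph → Set
TransmissionIrregular G = ∀ (u v : Fin (n G)) → Tr G u ≡ Tr G v → u ≡ v

Edge : Set
Edge = ℕ × ℕ

shareEnd : Edge → Edge → Bool
shareEnd (a , b) (c , d) =
  ⌊ a ≟ⁿ c ⌋ ∨ ⌊ a ≟ⁿ d ⌋ ∨ ⌊ b ≟ⁿ c ⌋ ∨ ⌊ b ≟ⁿ d ⌋

-- Line graph of a simple graph given by its (duplicate-free) edge list:
-- vertices are the edges, two distinct edges adjacent iff they share an end.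
lineGraph : List Edge → Graph
lineGraph es = record
  { n   = length es
  ; adj = λ i j → not ⌊ i ≟ᶠ j ⌋ ∧ shareEnd (lookup es i) (lookup es j) }

-- Starlike tree T(k1,k2,k3): center 0; the branch with offset o and length k
-- is the path 0 — o+1 — o+2 — … — o+k.
pathVertex : ℕ → ℕ → ℕ
pathVertex o zero    = 0
pathVertex o (suc j) = o + suc j

branch : ℕ → ℕ → List Edge
branch o zero    = []
branch o (suc k) = (pathVertex o k , o + suc k) ∷ branch o k

starlikeEdges : ℕ → ℕ → ℕ → List Edge
starlikeEdges k₁ k₂ k₃ = branch 0 k₁ ++ branch k₁ k₂ ++ branch (k₁ + k₂) k₃

lineStarlike : ℕ → ℕ → ℕ → Graph
lineStarlike k₁ k₂ k₃ = lineGraph (starlikeEdges k₁ k₂ k₃)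

module Submission where

-- Plan.  (1) A general criterion identifies the bounded-search distance
-- `dist` of any graph with a candidate function D that vanishes exactly on
-- the diagonal, changes by at most one along edges, always has a predecessor
-- one step closer, and is bounded by the number of vertices.  (2) For every
-- starlike tree T(k₁,k₂,k₃) we locate each edge (= vertex of the line graph)
-- by its branch and depth, show that the edge list has no repetitions, read
-- adjacency off positions, and verify the criterion for the explicit
-- position distance `posDist`; summing it branch by branch gives the
-- transmission as sums with closed forms.  (3) For T(a, a+1, a+2) this yields
-- 2·Tr(b, r) + 2(a + 1) = K + 2·weight(b, r), where the weight is a shift of
-- the quadratic x(x + a).  (4) Gaps between consecutive values of this
-- quadratic show that the weight is injective for even a, while for odd
-- a = 2c + 1 the positions (b₁, c) and (b₃, c + 1) share a weight; the
-- theorem follows.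

open import Defs
open import Data.Bool using (Bool; true; false; T; _∧_; if_then_else_)
open import Data.Bool.Properties using (T-∨; T-∧)
open import Data.Empty using (⊥-elim)
open import Data.Fin using (Fin; zero; suc)
open import Data.List using (List; []; _∷_; _++_; length; lookup; map; allFin; tabulate)
open import Data.List.Properties using (map-tabulate; tabulate-lookup; length-++; map-cong; map-++)
open import Data.List.Membership.Propositional using (_∈_)
open import Data.List.Membership.Propositional.Properties
  using (∈-lookup; ∈-allFin; ∈-++⁻; ∈-++⁺ˡ; ∈-++⁺ʳ)
open import Data.List.Relation.Binary.Disjoint.Propositional using (Disjoint)
open import Data.List.Relation.Unary.All as All using (_∷_)
open import Data.List.Relation.Unary.AllPairs using ([]; _∷_)
open import Data.List.Relation.Unary.Any as Any using (here; there)
open import Data.List.Relation.Unary.Any.Properties using (any⁺; any⁻; lookup-index)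
open import Data.List.Relation.Unary.Unique.Propositional using (Unique)
open import Data.List.Relation.Unary.Unique.Propositional.Properties using (++⁺)
open import Data.Nat
  using (ℕ; zero; suc; pred; _+_; _*_; _∸_; _≤_; _<_; z≤n; s≤s; z<s; ∣_-_∣; _≤?_)
open import Data.Nat.ListAction using (sum)
open import Data.Nat.ListAction.Properties using (sum-++)
open import Data.Nat.Properties
open import Data.Nat.Tactic.RingSolver using (solve-∀)
open import Data.Product using (Σ; _×_; _,_; proj₁; proj₂; ∃-syntax)
open import Data.Sum using (_⊎_; inj₁; inj₂; [_,_]′)
open import Function using (_∘_; id)
open import Function.Bundles using (Equivalence; _⇔_; mk⇔)
open import Data.Nat.Divisibility using (_∣_; divides)
open import Relation.Binary.Definitions using (DecidableEquality; tri<; tri≈; tri>)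
open import Relation.Binary.PropositionalEquality
  using (_≡_; _≢_; refl; sym; trans; cong; cong₂; subst; subst₂; module ≡-Reasoning)
open import Relation.Nullary using (¬_; yes; no; contradiction)
open import Relation.Nullary.Decidable
  using (does; dec-true; dec-false; toWitness; fromWitness; toWitnessFalse; fromWitnessFalse)

open Equivalence using (to; from)

least-threshold : (p : ℕ → Bool) (d : ℕ) →
                  (∀ j → T (p j) → d ≤ j) → (∀ j → d ≤ j → T (p j)) →
                  ∀ k fuel → k ≤ d → d ≤ k + fuel → least p k fuel ≡ d
least-threshold p d below above k zero k≤d d≤k+0 =
  ≤-antisym k≤d (subst (d ≤_) (+-identityʳ k) d≤k+0)
least-threshold p d below above k (suc fuel) k≤d d≤k+fuel with p k in pk
... | true = ≤-antisym k≤d (below k (subst T (sym pk) _))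
... | false with m≤n⇒m<n∨m≡n k≤d
...   | inj₁ k<d = least-threshold p d below above (suc k) fuel k<d
                     (subst (d ≤_) (+-suc k fuel) d≤k+fuel)
...   | inj₂ refl = ⊥-elim (subst T pk (above k ≤-refl))

record IsDistance (G : Graph) (D : Fin (n G) → Fin (n G) → ℕ) : Set where
  field
    zero⇒≡  : ∀ {u v} → D u v ≡ 0 → u ≡ v
    diagonal : ∀ u → D u u ≡ 0
    step     : ∀ {u w v} → T (adj G w v) → D u v ≤ suc (D u w)
    previous : ∀ {u v d} → D u v ≡ suc d → ∃[ w ] D u w ≡ d × T (adj G w v)
    bounded  : ∀ u v → D u v ≤ n G

module _ {G : Graph} {D : Fin (n G) → Fin (n G) → ℕ} (isD : IsDistance G D) where
  open IsDistance isD

  reach⇒≤ : ∀ k {u v} → T (reach G k u v) → D u v ≤ k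
  reach⇒≤ zero {u} r with toWitness r
  ... | refl = subst (_≤ 0) (sym (diagonal u)) ≤-refl
  reach⇒≤ (suc k) r with to T-∨ r
  ... | inj₁ r′ = m≤n⇒m≤1+n (reach⇒≤ k r′)
  ... | inj₂ r′ with Any.satisfied (any⁻ (λ w → reach G k _ w ∧ adj G w _) (allFin (n G)) r′)
  ...   | w , r″ with to T-∧ r″
  ...     | uw , wv = ≤-trans (step wv) (s≤s (reach⇒≤ k uw))

  ≤⇒reach : ∀ k {u v} → D u v ≤ k → T (reach G k u v)
  ≤⇒reach zero d≤0 with zero⇒≡ (n≤0⇒n≡0 d≤0)
  ... | refl = fromWitness refl
  ≤⇒reach (suc k) d≤k+1 with m≤n⇒m<n∨m≡n d≤k+1
  ... | inj₁ (s≤s d≤k) = from T-∨ (inj₁ (≤⇒reach k d≤k))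
  ... | inj₂ d≡k+1 with previous d≡k+1
  ...   | w , dw , wv = from T-∨ (inj₂ (any⁺ _
          (Any.map (λ { refl → from T-∧ (≤⇒reach k (≤-reflexive dw) , wv) }) (∈-allFin w))))

  dist≡ : ∀ u v → dist G u v ≡ D u v
  dist≡ u v = least-threshold _ (D u v) (λ j → reach⇒≤ j) (λ j → ≤⇒reach j)
                0 (n G) z≤n (bounded u v)

lookup-injective : ∀ {A : Set} {xs : List A} → Unique xs →
                   ∀ {i j} → lookup xs i ≡ lookup xs j → i ≡ j
lookup-injective (_ ∷ _) {zero} {zero} _ = refl
lookup-injective (x∉xs ∷ _) {zero} {suc j} eq = ⊥-elim (All.lookup x∉xs (∈-lookup j) eq)
lookup-injective (x∉xs ∷ _) {suc i} {zero} eq = ⊥-elim (All.lookup x∉xs (∈-lookup i) (sym eq))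
lookup-injective (_ ∷ unique) {suc i} {suc j} eq = cong suc (lookup-injective unique eq)

sum-over-positions : ∀ {A : Set} (f : A → ℕ) (xs : List A) →
                     sum (map (f ∘ lookup xs) (allFin (length xs))) ≡ sum (map f xs)
sum-over-positions f xs = cong sum (begin
  map (f ∘ lookup xs) (allFin (length xs)) ≡⟨ map-tabulate id (f ∘ lookup xs) ⟩
  tabulate (f ∘ lookup xs)                 ≡⟨ map-tabulate (lookup xs) f ⟨
  map f (tabulate (lookup xs))             ≡⟨ cong (map f) (tabulate-lookup xs) ⟩
  map f xs                                 ∎)
  where open ≡-Reasoning

SharedEnd : Edge → Edge → Set
SharedEnd (x , y) (x′ , y′) = x ≡ x′ ⊎ x ≡ y′ ⊎ y ≡ x′ ⊎ y ≡ y′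

shareEnd-sound : ∀ e f → T (shareEnd e f) → SharedEnd e f
shareEnd-sound (x , y) (x′ , y′) t with x ≟ x′ | x ≟ y′ | y ≟ x′ | y ≟ y′
... | yes eq | _      | _      | _      = inj₁ eq
... | no _   | yes eq | _      | _      = inj₂ (inj₁ eq)
... | no _   | no _   | yes eq | _      = inj₂ (inj₂ (inj₁ eq))
... | no _   | no _   | no _   | yes eq = inj₂ (inj₂ (inj₂ eq))
... | no _   | no _   | no _   | no _   = ⊥-elim t

shareEnd-complete : ∀ e f → SharedEnd e f → T (shareEnd e f)
shareEnd-complete (x , y) (x′ , y′) shared with x ≟ x′ | x ≟ y′ | y ≟ x′ | y ≟ y′
... | yes _ | _     | _     | _     = _
... | no _  | yes _ | _     | _     = _
... | no _  | no _  | yes _ | _     = _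
... | no _  | no _  | no _  | yes _ = _
... | no ¬a | no ¬b | no ¬c | no ¬d = [ ¬a , [ ¬b , [ ¬c , ¬d ]′ ]′ ]′ shared

pathEdge : ℕ → ℕ → Edge
pathEdge o r = (pathVertex o r , pathVertex o (suc r))

length-branch : ∀ o k → length (branch o k) ≡ k
length-branch o zero    = refl
length-branch o (suc k) = cong suc (length-branch o k)

∈-branch⁻ : ∀ {o k e} → e ∈ branch o k → ∃[ r ] r < k × e ≡ pathEdge o r
∈-branch⁻ {k = suc k} (here eq) = k , ≤-refl , eq
∈-branch⁻ {k = suc k} (there e∈) with ∈-branch⁻ e∈
... | r , r<k , eq = r , m≤n⇒m≤1+n r<k , eq

∈-branch⁺ : ∀ {o k r} → r < k → pathEdge o r ∈ branch o k
∈-branch⁺ {k = suc k} (s≤s r≤k) with m≤n⇒m<n∨m≡n r≤k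
... | inj₁ r<k  = there (∈-branch⁺ r<k)
... | inj₂ refl = here refl

far-in-branch : ∀ {o k e} → e ∈ branch o k → o < proj₂ e × proj₂ e ≤ o + k
far-in-branch {o} e∈ with ∈-branch⁻ e∈
... | r , r<k , refl = m<m+n o (s≤s z≤n) , +-monoʳ-≤ o r<k

unique-branch : ∀ o k → Unique (branch o k)
unique-branch o zero    = []
unique-branch o (suc k) =
  All.tabulate (λ e∈ eq → <-irrefl (cong proj₂ (sym eq))
    (≤-trans (s≤s (proj₂ (far-in-branch e∈))) (≤-reflexive (sym (+-suc o k)))))
  ∷ unique-branch o k

disjoint-branches : ∀ {o k o′ k′} → o + k ≤ o′ → Disjoint (branch o k) (branch o′ k′)
disjoint-branches o+k≤o′ (e∈ , e∈′) =
  <-irrefl refl (≤-<-trans (≤-trans (proj₂ (far-in-branch e∈)) o+k≤o′)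
                           (proj₁ (far-in-branch e∈′)))

sum-map-++ : ∀ {A : Set} (f : A → ℕ) xs ys → sum (map f (xs ++ ys)) ≡ sum (map f xs) + sum (map f ys)
sum-map-++ f xs ys = trans (cong sum (map-++ f xs ys)) (sum-++ (map f xs) (map f ys))

-- sumBelow f k = Σ_{q < k} f q, accumulated in the order of `branch`.
sumBelow : (ℕ → ℕ) → ℕ → ℕ
sumBelow f zero    = 0
sumBelow f (suc k) = f k + sumBelow f k

sum-branch : ∀ (f : Edge → ℕ) o k →
             sum (map f (branch o k)) ≡ sumBelow (λ r → f (pathEdge o r)) k
sum-branch f o zero    = refl
sum-branch f o (suc k) = cong (f (pathEdge o k) +_) (sum-branch f o k)

sumBelow-cong : ∀ {f g} k → (∀ q → q < k → f q ≡ g q) → sumBelow f k ≡ sumBelow g k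
sumBelow-cong zero    f≡g = refl
sumBelow-cong (suc k) f≡g = cong₂ _+_ (f≡g k ≤-refl) (sumBelow-cong k (λ q q<k → f≡g q (m<n⇒m<1+n q<k)))

sumBelow-split : ∀ f k m → sumBelow f (k + m) ≡ sumBelow (λ j → f (k + j)) m + sumBelow f k
sumBelow-split f k zero    = cong (λ l → sumBelow f l) (+-identityʳ k)
sumBelow-split f k (suc m) = begin
  sumBelow f (k + suc m)                          ≡⟨ cong (sumBelow f) (+-suc k m) ⟩
  f (k + m) + sumBelow f (k + m)                  ≡⟨ cong (f (k + m) +_) (sumBelow-split f k m) ⟩
  f (k + m) + (sumBelow (λ j → f (k + j)) m + sumBelow f k) ≡⟨ +-assoc (f (k + m)) _ _ ⟨
  sumBelow (λ j → f (k + j)) (suc m) + sumBelow f k ∎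
  where open ≡-Reasoning

-- Distances from depth r to the l edges of another branch, and to the l
-- edges of its own branch.
acrossSum : ℕ → ℕ → ℕ
acrossSum l r = sumBelow (λ q → suc (q + r)) l

withinSum : ℕ → ℕ → ℕ
withinSum l r = sumBelow (λ q → ∣ q - r ∣) l

acrossSum-closed : ∀ l r → 2 * acrossSum l r ≡ l * suc l + 2 * (l * r)
acrossSum-closed zero    r = refl
acrossSum-closed (suc l) r = begin
  2 * (suc (l + r) + sumBelow (λ q → suc (q + r)) l)      ≡⟨ *-distribˡ-+ 2 (suc (l + r)) _ ⟩
  2 * suc (l + r) + 2 * sumBelow (λ q → suc (q + r)) l    ≡⟨ cong (2 * suc (l + r) +_) (acrossSum-closed l r) ⟩
  2 * suc (l + r) + (l * suc l + 2 * (l * r))             ≡⟨ step l r ⟩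
  suc l * suc (suc l) + 2 * (suc l * r)                   ∎
  where
    open ≡-Reasoning
    step : ∀ l r → 2 * suc (l + r) + (l * suc l + 2 * (l * r)) ≡ suc l * suc (suc l) + 2 * (suc l * r)
    step = solve-∀

sum-toward : ∀ k n → 2 * sumBelow (λ q → ∣ q - (n + k) ∣) k ≡ k * suc k + 2 * (k * n)
sum-toward zero    n = refl
sum-toward (suc k) n rewrite +-suc n k = begin
  2 * (∣ k - suc (n + k) ∣ + S)        ≡⟨ cong (λ d → 2 * (d + S)) gap ⟩
  2 * (suc n + S)                      ≡⟨ *-distribˡ-+ 2 (suc n) S ⟩
  2 * suc n + 2 * S                    ≡⟨ cong (2 * suc n +_) (sum-toward k (suc n)) ⟩
  2 * suc n + (k * suc k + 2 * (k * suc n)) ≡⟨ step k n ⟩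
  suc k * suc (suc k) + 2 * (suc k * n) ∎
  where
    open ≡-Reasoning
    S = sumBelow (λ q → ∣ q - suc (n + k) ∣) k
    gap : ∣ k - suc (n + k) ∣ ≡ suc n
    gap = trans (cong (λ m → ∣ k - m ∣) (trans (cong suc (+-comm n k)) (sym (+-suc k n))))
                (∣m-m+n∣≡n k (suc n))
    step : ∀ k n → 2 * suc n + (k * suc k + 2 * (k * suc n)) ≡ suc k * suc (suc k) + 2 * (suc k * n)
    step = solve-∀

-- For r < l: 2 Σ_{q<l} |q − r| = (l − r − 1)(l − r) + r(r + 1), written
-- without subtraction.
withinSum-closed : ∀ l r → r < l →
                   2 * withinSum l r + 2 * (suc l * suc r) ≡ l * suc l + 2 * (suc r * suc r)
withinSum-closed l r r<l with m≤n⇒∃[o]m+o≡n r<l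
... | m , refl = begin
  2 * sumBelow (λ q → ∣ q - r ∣) (suc r + m) + X
    ≡⟨ cong (λ s → 2 * s + X) (sumBelow-split _ (suc r) m) ⟩
  2 * (A + (∣ r - r ∣ + B)) + X
    ≡⟨ cong (λ d → 2 * (A + (d + B)) + X) (∣n-n∣≡0 r) ⟩
  2 * (A + B) + X
    ≡⟨ cong (_+ X) (*-distribˡ-+ 2 A B) ⟩
  2 * A + 2 * B + X
    ≡⟨ cong₂ (λ α β → α + β + X) beyond (sum-toward r 0) ⟩
  m * suc m + 2 * (m * 0) + (r * suc r + 2 * (r * 0)) + X
    ≡⟨ combine r m ⟩
  (suc r + m) * suc (suc r + m) + 2 * (suc r * suc r) ∎
  where
    open ≡-Reasoning
    X = 2 * (suc (suc r + m) * suc r)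
    A = sumBelow (λ j → ∣ suc r + j - r ∣) m
    B = sumBelow (λ q → ∣ q - r ∣) r
    beyond : 2 * A ≡ m * suc m + 2 * (m * 0)
    beyond = trans (cong (2 *_) (sumBelow-cong m (λ j _ → trans
               (trans (∣-∣-comm (suc r + j) r) (cong (λ t → ∣ r - t ∣) (sym (+-suc r j))))
               (trans (∣m-m+n∣≡n r (suc j)) (cong suc (sym (+-identityʳ j)))))))
             (acrossSum-closed m 0)
    combine : ∀ r m → m * suc m + 2 * (m * 0) + (r * suc r + 2 * (r * 0)) + 2 * (suc (suc r + m) * suc r)
                      ≡ (suc r + m) * suc (suc r + m) + 2 * (suc r * suc r)
    combine = solve-∀

data Branch : Set where
  b₁ b₂ b₃ : Branch

_≟ᴮ_ : DecidableEquality Branch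
b₁ ≟ᴮ b₁ = yes refl
b₁ ≟ᴮ b₂ = no λ ()
b₁ ≟ᴮ b₃ = no λ ()
b₂ ≟ᴮ b₁ = no λ ()
b₂ ≟ᴮ b₂ = yes refl
b₂ ≟ᴮ b₃ = no λ ()
b₃ ≟ᴮ b₁ = no λ ()
b₃ ≟ᴮ b₂ = no λ ()
b₃ ≟ᴮ b₃ = yes refl

-- An edge of the tree, i.e. a vertex of its line graph, is located by its
-- branch and its depth r (it joins depths r and r + 1 of that branch).
Pos : Set
Pos = Branch × ℕ

data Adjacent : Pos → Pos → Set where
  central : ∀ {b c} → b ≢ c → Adjacent (b , 0) (c , 0)
  outward : ∀ {b r} → Adjacent (b , r) (b , suc r)
  inward  : ∀ {b r} → Adjacent (b , suc r) (b , r)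

adjacent-irreflexive : ∀ {p q} → Adjacent p q → p ≢ q
adjacent-irreflexive (central b≢c) eq = b≢c (cong proj₁ eq)
adjacent-irreflexive outward       eq = 1+n≢n (sym (cong proj₂ eq))
adjacent-irreflexive inward        eq = 1+n≢n (cong proj₂ eq)

posDist : Pos → Pos → ℕ
posDist (b , r) (c , s) = if does (b ≟ᴮ c) then ∣ r - s ∣ else suc (r + s)

posDist-same : ∀ b r s → posDist (b , r) (b , s) ≡ ∣ r - s ∣
posDist-same b r s rewrite dec-true (b ≟ᴮ b) refl = refl

posDist-other : ∀ {b c} r s → b ≢ c → posDist (b , r) (c , s) ≡ suc (r + s)
posDist-other {b} {c} r s b≢c rewrite dec-false (b ≟ᴮ c) b≢c = refl

posDist-self : ∀ p → posDist p p ≡ 0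
posDist-self (b , r) = trans (posDist-same b r r) (∣n-n∣≡0 r)

posDist-zero : ∀ {p q} → posDist p q ≡ 0 → p ≡ q
posDist-zero {b , r} {c , s} d≡0 with b ≟ᴮ c
... | yes refl = cong (b ,_) (∣m-n∣≡0⇒m≡n d≡0)
... | no _     = contradiction d≡0 λ ()

∣n-1+n∣≡1 : ∀ n → ∣ n - suc n ∣ ≡ 1
∣n-1+n∣≡1 zero    = refl
∣n-1+n∣≡1 (suc n) = ∣n-1+n∣≡1 n

∣-∣-suc≤ : ∀ r s → ∣ r - suc s ∣ ≤ suc ∣ r - s ∣
∣-∣-suc≤ r s = ≤-trans (∣-∣-triangle r s (suc s))
  (≤-reflexive (trans (cong (∣ r - s ∣ +_) (∣n-1+n∣≡1 s)) (+-comm ∣ r - s ∣ 1)))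

∣-∣-≤suc : ∀ r s → ∣ r - s ∣ ≤ suc ∣ r - suc s ∣
∣-∣-≤suc r s = ≤-trans (∣-∣-triangle r (suc s) s)
  (≤-reflexive (trans (cong (∣ r - suc s ∣ +_) (trans (∣-∣-comm (suc s) s) (∣n-1+n∣≡1 s)))
                      (+-comm ∣ r - suc s ∣ 1)))

posDist-centre : ∀ b r c → r ≤ posDist (b , r) (c , 0) × posDist (b , r) (c , 0) ≤ suc r
posDist-centre b r c with b ≟ᴮ c
... | yes refl rewrite ∣-∣-identityʳ r = ≤-refl , n≤1+n r
... | no _     rewrite +-identityʳ r = n≤1+n r , ≤-refl

posDist-step : ∀ u {w v} → Adjacent w v → posDist u v ≤ suc (posDist u w)
posDist-step (b , r) (central {c} {c′} _) =
  ≤-trans (proj₂ (posDist-centre b r c′)) (s≤s (proj₁ (posDist-centre b r c)))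
posDist-step (b , r) (outward {c} {s}) with b ≟ᴮ c
... | yes refl = ∣-∣-suc≤ r s
... | no _     = ≤-reflexive (cong suc (+-suc r s))
posDist-step (b , r) (inward {c} {s}) with b ≟ᴮ c
... | yes refl = ∣-∣-≤suc r s
... | no _     = s≤s (≤-trans (+-monoʳ-≤ r (n≤1+n s)) (n≤1+n _))

∣-∣-previous : ∀ r s {d} → ∣ r - s ∣ ≡ suc d →
               (∃[ s′ ] s ≡ suc s′ × ∣ r - s′ ∣ ≡ d) ⊎ (s < r × ∣ r - suc s ∣ ≡ d)
∣-∣-previous zero    (suc s) eq = inj₁ (s , refl , suc-injective eq)
∣-∣-previous (suc r) zero    eq = inj₂ (s≤s z≤n , trans (∣-∣-identityʳ r) (suc-injective eq))
∣-∣-previous (suc r) (suc s) eq with ∣-∣-previous r s eq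
... | inj₁ (s′ , refl , e) = inj₁ (suc s′ , refl , e)
... | inj₂ (s<r , e)       = inj₂ (s≤s s<r , e)

module Starlike (k₁ k₂ k₃ : ℕ) where

  len : Branch → ℕ
  len b₁ = k₁
  len b₂ = k₂
  len b₃ = k₃

  -- Vertex labels of branch b are off b + 1, …, off b + len b.
  off : Branch → ℕ
  off b₁ = 0
  off b₂ = k₁
  off b₃ = k₁ + k₂

  total : ℕ
  total = k₁ + (k₂ + k₃)

  Valid : Pos → Set
  Valid (b , r) = r < len b

  edgeAt : Pos → Edge
  edgeAt (b , r) = pathEdge (off b) r

  edges : List Edge
  edges = starlikeEdges k₁ k₂ k₃

  ∈-edges⁻ : ∀ {e} → e ∈ edges → ∃[ p ] Valid p × e ≡ edgeAt p
  ∈-edges⁻ e∈ with ∈-++⁻ (branch 0 k₁) e∈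
  ... | inj₁ e∈₁ with ∈-branch⁻ e∈₁
  ...   | r , r< , eq = (b₁ , r) , r< , eq
  ∈-edges⁻ e∈ | inj₂ e∈₂₃ with ∈-++⁻ (branch k₁ k₂) e∈₂₃
  ... | inj₁ e∈₂ with ∈-branch⁻ e∈₂
  ...   | r , r< , eq = (b₂ , r) , r< , eq
  ∈-edges⁻ e∈ | inj₂ e∈₂₃ | inj₂ e∈₃ with ∈-branch⁻ e∈₃
  ...   | r , r< , eq = (b₃ , r) , r< , eq

  ∈-edges⁺ : ∀ {p} → Valid p → edgeAt p ∈ edges
  ∈-edges⁺ {b₁ , r} r< = ∈-++⁺ˡ (∈-branch⁺ r<)
  ∈-edges⁺ {b₂ , r} r< = ∈-++⁺ʳ (branch 0 k₁) (∈-++⁺ˡ (∈-branch⁺ r<))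
  ∈-edges⁺ {b₃ , r} r< = ∈-++⁺ʳ (branch 0 k₁) (∈-++⁺ʳ (branch k₁ k₂) (∈-branch⁺ r<))

  -- The three branches use disjoint label intervals, so no edge repeats.
  unique-edges : Unique edges
  unique-edges = ++⁺ (unique-branch 0 k₁)
    (++⁺ (unique-branch k₁ k₂) (unique-branch (k₁ + k₂) k₃) (disjoint-branches ≤-refl))
    (λ (e∈₁ , e∈₂₃) → [ (λ e∈₂ → disjoint-branches ≤-refl (e∈₁ , e∈₂))
                      , (λ e∈₃ → disjoint-branches (m≤m+n k₁ k₂) (e∈₁ , e∈₃)) ]′
                      (∈-++⁻ (branch k₁ k₂) e∈₂₃))

  length-edges : length edges ≡ total
  length-edges = begin
    length edges                                   ≡⟨ length-++ (branch 0 k₁) ⟩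
    length (branch 0 k₁) + length (branch k₁ k₂ ++ branch (k₁ + k₂) k₃)
      ≡⟨ cong (length (branch 0 k₁) +_) (length-++ (branch k₁ k₂)) ⟩
    length (branch 0 k₁) + (length (branch k₁ k₂) + length (branch (k₁ + k₂) k₃))
      ≡⟨ cong₂ _+_ (length-branch 0 k₁)
                   (cong₂ _+_ (length-branch k₁ k₂) (length-branch (k₁ + k₂) k₃)) ⟩
    total                                          ∎
    where open ≡-Reasoning

  -- The position of the edge whose far end carries the label y.
  locate : ℕ → Pos
  locate y with y ≤? k₁
  ... | yes _ = b₁ , pred y
  ... | no _ with y ≤? k₁ + k₂
  ...   | yes _ = b₂ , y ∸ suc k₁
  ...   | no _  = b₃ , y ∸ suc (k₁ + k₂)

  locate-far : ∀ {p} → Valid p → locate (proj₂ (edgeAt p)) ≡ p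
  locate-far {b₁ , r} r< with suc r ≤? k₁
  ... | yes _  = refl
  ... | no r≮ = contradiction r< r≮
  locate-far {b₂ , r} r< with k₁ + suc r ≤? k₁
  ... | yes le = contradiction le (m+1+n≰m k₁)
  ... | no _ with k₁ + suc r ≤? k₁ + k₂
  ...   | yes _ = cong (b₂ ,_) (trans (cong (_∸ suc k₁) (+-suc k₁ r)) (m+n∸m≡n k₁ r))
  ...   | no ≰ = contradiction (+-monoʳ-≤ k₁ r<) ≰
  locate-far {b₃ , r} r< with k₁ + k₂ + suc r ≤? k₁
  ... | yes le = contradiction (≤-trans (+-monoˡ-≤ (suc r) (m≤m+n k₁ k₂)) le) (m+1+n≰m k₁)
  ... | no _ with k₁ + k₂ + suc r ≤? k₁ + k₂
  ...   | yes le = contradiction le (m+1+n≰m (k₁ + k₂))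
  ...   | no _ = cong (b₃ ,_)
                   (trans (cong (_∸ suc (k₁ + k₂)) (+-suc (k₁ + k₂) r)) (m+n∸m≡n (k₁ + k₂) r))

  vertex-≡ : ∀ {b c q s} → q ≤ len b → s ≤ len c →
             pathVertex (off b) q ≡ pathVertex (off c) s → (q ≡ 0 × s ≡ 0) ⊎ (b ≡ c × q ≡ s)
  vertex-≡ {q = zero}  {zero}  _ _ _ = inj₁ (refl , refl)
  vertex-≡ {c = c} {q = zero} {suc s} _ _ eq = contradiction (sym eq) (m+1+n≢0 (off c))
  vertex-≡ {b = b} {q = suc q} {zero} _ _ eq = contradiction eq (m+1+n≢0 (off b))
  vertex-≡ {b} {c} {suc q} {suc s} q< s< eq
    with trans (sym (locate-far {b , q} q<)) (trans (cong locate eq) (locate-far {c , s} s<))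
  ... | refl = inj₂ (refl , refl)

  adjacent⇒shared : ∀ {p q} → Adjacent p q → SharedEnd (edgeAt p) (edgeAt q)
  adjacent⇒shared (central _) = inj₁ refl
  adjacent⇒shared outward     = inj₂ (inj₂ (inj₁ refl))
  adjacent⇒shared inward      = inj₂ (inj₁ refl)

  shared⇒adjacent : ∀ {p q} → Valid p → Valid q → p ≢ q →
                    SharedEnd (edgeAt p) (edgeAt q) → Adjacent p q
  shared⇒adjacent {b , r} {c , s} vp vq p≢q (inj₁ near≡near)
    with vertex-≡ {b} {c} (<⇒≤ vp) (<⇒≤ vq) near≡near
  ... | inj₂ (refl , refl) = contradiction refl p≢q
  ... | inj₁ (refl , refl) with b ≟ᴮ c
  ...   | yes refl = contradiction refl p≢q
  ...   | no b≢c   = central b≢c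
  shared⇒adjacent {b , r} {c , s} vp vq p≢q (inj₂ (inj₁ near≡far))
    with vertex-≡ {b} {c} (<⇒≤ vp) vq near≡far
  ... | inj₁ (_ , ())
  ... | inj₂ (refl , refl) = inward
  shared⇒adjacent {b , r} {c , s} vp vq p≢q (inj₂ (inj₂ (inj₁ far≡near)))
    with vertex-≡ {b} {c} vp (<⇒≤ vq) far≡near
  ... | inj₁ (() , _)
  ... | inj₂ (refl , refl) = outward
  shared⇒adjacent {b , r} {c , s} vp vq p≢q (inj₂ (inj₂ (inj₂ far≡far)))
    with vertex-≡ {b} {c} vp vq far≡far
  ... | inj₁ (() , _)
  ... | inj₂ (refl , refl) = contradiction refl p≢q

  posDist-previous : ∀ {u v d} → Valid u → Valid v → posDist u v ≡ suc d →
                     ∃[ w ] Valid w × Adjacent w v × posDist u w ≡ d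
  posDist-previous {b , r} {c , s} vu vv eq with b ≟ᴮ c
  ... | yes refl with ∣-∣-previous r s eq
  ...   | inj₁ (s′ , refl , e) =
          (b , s′) , ≤-trans (n≤1+n _) vv , outward , trans (posDist-same b r s′) e
  ...   | inj₂ (s<r , e) =
          (b , suc s) , ≤-<-trans s<r vu , inward , trans (posDist-same b r (suc s)) e
  posDist-previous {b , r} {c , zero} vu vv eq | no b≢c =
    (b , 0) , ≤-trans (s≤s z≤n) vu , central b≢c ,
    trans (posDist-same b r 0) (trans (∣-∣-identityʳ r) (trans (sym (+-identityʳ r)) (suc-injective eq)))
  posDist-previous {b , r} {c , suc s} vu vv eq | no b≢c =
    (c , s) , ≤-trans (n≤1+n _) vv , outward ,
    trans (posDist-other r s b≢c) (trans (sym (+-suc r s)) (suc-injective eq))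

  len≤total : ∀ b → len b ≤ total
  len≤total b₁ = m≤m+n k₁ (k₂ + k₃)
  len≤total b₂ = ≤-trans (m≤m+n k₂ k₃) (m≤n+m (k₂ + k₃) k₁)
  len≤total b₃ = ≤-trans (m≤n+m k₃ k₂) (m≤n+m (k₂ + k₃) k₁)

  lens≤total : ∀ {b c} → b ≢ c → len b + len c ≤ total
  lens≤total {b₁} {b₁} b≢c = contradiction refl b≢c
  lens≤total {b₂} {b₂} b≢c = contradiction refl b≢c
  lens≤total {b₃} {b₃} b≢c = contradiction refl b≢c
  lens≤total {b₁} {b₂} _ = +-monoʳ-≤ k₁ (m≤m+n k₂ k₃)
  lens≤total {b₁} {b₃} _ = +-monoʳ-≤ k₁ (m≤n+m k₃ k₂)
  lens≤total {b₂} {b₃} _ = m≤n+m (k₂ + k₃) k₁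
  lens≤total {b₂} {b₁} _ = ≤-trans (≤-reflexive (+-comm k₂ k₁)) (+-monoʳ-≤ k₁ (m≤m+n k₂ k₃))
  lens≤total {b₃} {b₁} _ = ≤-trans (≤-reflexive (+-comm k₃ k₁)) (+-monoʳ-≤ k₁ (m≤n+m k₃ k₂))
  lens≤total {b₃} {b₂} _ = ≤-trans (≤-reflexive (+-comm k₃ k₂)) (m≤n+m (k₂ + k₃) k₁)

  posDist-bound : ∀ {u v} → Valid u → Valid v → posDist u v ≤ total
  posDist-bound {b , r} {c , s} vu vv with b ≟ᴮ c
  ... | yes refl = ≤-trans (∣m-n∣≤m⊔n r s) (≤-trans (<⇒≤ (⊔-lub vu vv)) (len≤total b))
  ... | no b≢c   = ≤-trans (+-mono-≤ vu (<⇒≤ vv)) (lens≤total b≢c)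

  L : Graph
  L = lineStarlike k₁ k₂ k₃

  pos : Fin (n L) → Pos
  pos u = locate (proj₂ (lookup edges u))

  pos-spec : ∀ u → Valid (pos u) × lookup edges u ≡ edgeAt (pos u)
  pos-spec u with ∈-edges⁻ (∈-lookup u)
  ... | p , vp , eq rewrite eq | locate-far vp = vp , refl

  pos-valid : ∀ u → Valid (pos u)
  pos-valid u = proj₁ (pos-spec u)

  pos-edge : ∀ u → lookup edges u ≡ edgeAt (pos u)
  pos-edge u = proj₂ (pos-spec u)

  pos-injective : ∀ {u v} → pos u ≡ pos v → u ≡ v
  pos-injective {u} {v} eq =
    lookup-injective unique-edges (trans (pos-edge u) (trans (cong edgeAt eq) (sym (pos-edge v))))

  vertexAt : ∀ {p} → Valid p → Σ (Fin (n L)) λ u → pos u ≡ p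
  vertexAt vp = Any.index e∈ , trans (cong (locate ∘ proj₂) (sym (lookup-index e∈))) (locate-far vp)
    where e∈ = ∈-edges⁺ vp

  adj⇒adjacent : ∀ {w v} → T (adj L w v) → Adjacent (pos w) (pos v)
  adj⇒adjacent {w} {v} wv with to T-∧ wv
  ... | w≢v , shared = shared⇒adjacent (pos-valid w) (pos-valid v)
          (λ eq → toWitnessFalse w≢v (pos-injective eq))
          (subst₂ SharedEnd (pos-edge w) (pos-edge v) (shareEnd-sound _ _ shared))

  adjacent⇒adj : ∀ {w v} → Adjacent (pos w) (pos v) → T (adj L w v)
  adjacent⇒adj {w} {v} a = from T-∧
    ( fromWitnessFalse (λ w≡v → adjacent-irreflexive a (cong pos w≡v))
    , shareEnd-complete _ _ (subst₂ SharedEnd (sym (pos-edge w)) (sym (pos-edge v)) (adjacent⇒shared a)))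

  isDistance : IsDistance L (λ u v → posDist (pos u) (pos v))
  isDistance = record
    { zero⇒≡  = pos-injective ∘ posDist-zero
    ; diagonal = λ u → posDist-self (pos u)
    ; step     = λ {u} wv → posDist-step (pos u) (adj⇒adjacent wv)
    ; previous = previous
    ; bounded  = λ u v → subst (posDist (pos u) (pos v) ≤_) (sym length-edges)
                                (posDist-bound (pos-valid u) (pos-valid v))
    }
    where
      previous : ∀ {u v d} → posDist (pos u) (pos v) ≡ suc d →
                 ∃[ w ] posDist (pos u) (pos w) ≡ d × T (adj L w v)
      previous {u} {v} eq with posDist-previous (pos-valid u) (pos-valid v) eq
      ... | p , vp , a , e with vertexAt vp
      ...   | w , refl = w , e , adjacent⇒adj a

  posTr : Pos → ℕ
  posTr q = branchSum b₁ + (branchSum b₂ + branchSum b₃)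
    where branchSum : Branch → ℕ
          branchSum b = sumBelow (λ r → posDist (b , r) q) (len b)

  Tr≡posTr : ∀ v → Tr L v ≡ posTr (pos v)
  Tr≡posTr v = begin
    sum (map (λ u → dist L u v) (allFin (n L)))
      ≡⟨ cong sum (map-cong (λ u → dist≡ isDistance u v) (allFin (n L))) ⟩
    sum (map (f ∘ lookup edges) (allFin (n L)))
      ≡⟨ sum-over-positions f edges ⟩
    sum (map f (branch 0 k₁ ++ branch k₁ k₂ ++ branch (k₁ + k₂) k₃))
      ≡⟨ sum-map-++ f (branch 0 k₁) _ ⟩
    sum (map f (branch 0 k₁)) + sum (map f (branch k₁ k₂ ++ branch (k₁ + k₂) k₃))
      ≡⟨ cong (sum (map f (branch 0 k₁)) +_) (sum-map-++ f (branch k₁ k₂) _) ⟩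
    sum (map f (branch 0 k₁)) + (sum (map f (branch k₁ k₂)) + sum (map f (branch (k₁ + k₂) k₃)))
      ≡⟨ cong₂ _+_ (along b₁) (cong₂ _+_ (along b₂) (along b₃)) ⟩
    posTr (pos v) ∎
    where
      open ≡-Reasoning
      f : Edge → ℕ
      f e = posDist (locate (proj₂ e)) (pos v)
      along : ∀ b → sum (map f (branch (off b) (len b))) ≡ sumBelow (λ r → posDist (b , r) (pos v)) (len b)
      along b = trans (sum-branch f (off b) (len b))
        (sumBelow-cong (len b) (λ r r< → cong (λ p → posDist p (pos v)) (locate-far {b , r} r<)))

-- The quadratic x ↦ x(x + a) that governs transmissions in L(T(a, a+1, a+2)).
quad : ℕ → ℕ → ℕ
quad a x = x * (x + a)

quad-suc : ∀ a y → quad a (suc y) ≡ suc (2 * y + a) + quad a y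
quad-suc = expand
  where expand : ∀ a y → suc y * (suc y + a) ≡ suc (2 * y + a) + y * (y + a)
        expand = solve-∀

quad-mono : ∀ a {x y} → x ≤ y → quad a x ≤ quad a y
quad-mono a x≤y = *-mono-≤ x≤y (+-monoˡ-≤ a x≤y)

quad-< : ∀ a {x y} → x < y → quad a x < quad a y
quad-< a {x} x<y = <-≤-trans (m<n+m (quad a x) z<s)
  (≤-trans (≤-reflexive (sym (quad-suc a x))) (quad-mono a x<y))

quad-injective : ∀ a {x y} → quad a x ≡ quad a y → x ≡ y
quad-injective a {x} {y} eq with <-cmp x y
... | tri< x<y _ _ = contradiction eq (<⇒≢ (quad-< a x<y))
... | tri≈ _ x≡y _ = x≡y
... | tri> _ _ y<x = contradiction (sym eq) (<⇒≢ (quad-< a y<x))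

quad-gap : ∀ a x y d e → quad a (suc y) ≡ suc d + suc e + quad a y → quad a x ≢ suc d + quad a y
quad-gap a x y d e step eq with x ≤? y
... | yes x≤y = <⇒≱ (m<n+m (quad a y) z<s) (subst (_≤ quad a y) eq (quad-mono a x≤y))
... | no  x≰y = <⇒≱ (+-monoˡ-< (quad a y) (m<m+n (suc d) z<s))
                    (subst₂ _≤_ step eq (quad-mono a (≰⇒> x≰y)))

-- Position (b, r) of L(T(a, a+1, a+2)) has weight shift b + quad a (key b r);
-- transmissions turn out to be an affine function of the weight.
key : Branch → ℕ → ℕ
key b₁ r = suc (suc r)
key b₂ r = suc r
key b₃ r = r

shift : ℕ → Branch → ℕ
shift a b₁ = 0
shift a b₂ = 2 + a
shift a b₃ = 2 + a + a

weight : ℕ → Pos → ℕ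
weight a (b , r) = shift a b + quad a (key b r)

key-injective : ∀ b {r s} → key b r ≡ key b s → r ≡ s
key-injective b₁ = suc-injective ∘ suc-injective
key-injective b₂ = suc-injective
key-injective b₃ = id

-- Branches b₁/b₂ and b₂/b₃ never share a weight: the shifts between them fall
-- strictly inside a gap of quad a.
weights₁₂ : ∀ a r s → weight a (b₁ , r) ≢ weight a (b₂ , s)
weights₁₂ a r s = quad-gap a (suc (suc r)) (suc s) (suc a) (2 * s) (gap a s)
  where gap : ∀ a s → suc (suc s) * (suc (suc s) + a) ≡ suc (suc a) + suc (2 * s) + suc s * (suc s + a)
        gap = solve-∀

weights₂₃ : ∀ a → 0 < a → ∀ r s → weight a (b₂ , r) ≢ weight a (b₃ , s)
weights₂₃ (suc a₀) _ r s eq = quad-gap (suc a₀) (suc r) s a₀ (2 * s) (gap a₀ s)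
  (+-cancelˡ-≡ (2 + suc a₀) _ _ (trans eq (+-assoc (2 + suc a₀) (suc a₀) (quad (suc a₀) s))))
  where gap : ∀ a₀ s → suc s * (suc s + suc a₀) ≡ suc a₀ + suc (2 * s) + s * (s + suc a₀)
        gap = solve-∀

-- Branches b₁/b₃ share no weight when a is even: the shift 2a + 2 lies inside
-- the gap after quad a s or after quad a (s + 1), according as 2s > a or 2s ≤ a.
weights₁₃ : ∀ a c → a ≡ c * 2 → ∀ r s → weight a (b₁ , r) ≢ weight a (b₃ , s)
weights₁₃ a c refl r s eq with s ≤? c
... | yes s≤c with m≤n⇒∃[o]m+o≡n s≤c
...   | k , refl =
  quad-gap ((s + k) * 2) (suc (suc r)) (suc s) (2 * k) (4 * s + 1) (gap s k) (trans eq (shiftUp s k))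
  where
    shiftUp : ∀ s k → 2 + (s + k) * 2 + (s + k) * 2 + s * (s + (s + k) * 2)
                      ≡ suc (2 * k) + suc s * (suc s + (s + k) * 2)
    shiftUp = solve-∀
    gap : ∀ s k → suc (suc s) * (suc (suc s) + (s + k) * 2)
                  ≡ suc (2 * k) + suc (4 * s + 1) + suc s * (suc s + (s + k) * 2)
    gap = solve-∀
weights₁₃ a c refl r s eq | no s≰c with m≤n⇒∃[o]m+o≡n (≰⇒> s≰c)
...   | k , refl = quad-gap (c * 2) (suc (suc r)) (suc c + k) (suc (c * 2 + c * 2)) (2 * k) (gap c k) eq
  where
    gap : ∀ c k → suc (suc c + k) * (suc (suc c + k) + c * 2)
                  ≡ suc (suc (c * 2 + c * 2)) + suc (2 * k) + (suc c + k) * ((suc c + k) + c * 2)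
    gap = solve-∀

weight-injective : ∀ a c → a ≡ c * 2 → 0 < a → ∀ {p q} → weight a p ≡ weight a q → p ≡ q
weight-injective a c even a>0 {b , r} {b′ , s} eq with b ≟ᴮ b′
... | yes refl = cong (b ,_) (key-injective b (quad-injective a (+-cancelˡ-≡ (shift a b) _ _ eq)))
... | no b≢b′ = contradiction eq (distinct b b′ b≢b′)
  where
    distinct : ∀ b b′ → b ≢ b′ → weight a (b , r) ≢ weight a (b′ , s)
    distinct b₁ b₁ b≢b′ = contradiction refl b≢b′
    distinct b₂ b₂ b≢b′ = contradiction refl b≢b′
    distinct b₃ b₃ b≢b′ = contradiction refl b≢b′
    distinct b₁ b₂ _ = weights₁₂ a r s
    distinct b₂ b₁ _ = weights₁₂ a s r ∘ sym
    distinct b₂ b₃ _ = weights₂₃ a a>0 r s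
    distinct b₃ b₂ _ = weights₂₃ a a>0 s r ∘ sym
    distinct b₁ b₃ _ = weights₁₃ a c even r s
    distinct b₃ b₁ _ = weights₁₃ a c even s r ∘ sym

odd-collision : ∀ c → weight (suc (c * 2)) (b₁ , c) ≡ weight (suc (c * 2)) (b₃ , suc c)
odd-collision = collide
  where collide : ∀ c → 0 + suc (suc c) * (suc (suc c) + suc (c * 2))
                        ≡ 2 + suc (c * 2) + suc (c * 2) + suc c * (suc c + suc (c * 2))
        collide = solve-∀

even-or-odd : ∀ n → 2 ∣ n ⊎ ∃[ c ] n ≡ suc (c * 2)
even-or-odd zero    = inj₁ (divides 0 refl)
even-or-odd (suc n) with even-or-odd n
... | inj₁ (divides c n≡2c) = inj₂ (c , cong suc n≡2c)
... | inj₂ (c , n≡1+2c)     = inj₁ (divides (suc c) (cong suc n≡1+2c))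

transmission-parts : ∀ P O C C′ {X α γ γ′} → P ≡ O + (C + C′) →
                     2 * O + X ≡ α → 2 * C ≡ γ → 2 * C′ ≡ γ′ → 2 * P + X ≡ α + (γ + γ′)
transmission-parts _ O C C′ {X} refl refl refl refl = regroup O C C′ X
  where regroup : ∀ O C C′ X → 2 * (O + (C + C′)) + X ≡ (2 * O + X) + (2 * C + 2 * C′)
        regroup = solve-∀

cancel-offset : ∀ P {X S c R} → 2 * P + X ≡ S → S + c ≡ R + X → 2 * P + c ≡ R
cancel-offset P {X} {S} {c} {R} hS hR = +-cancelʳ-≡ X (2 * P + c) R (begin
  2 * P + c + X   ≡⟨ +-assoc (2 * P) c X ⟩
  2 * P + (c + X) ≡⟨ cong (2 * P +_) (+-comm c X) ⟩
  2 * P + (X + c) ≡⟨ +-assoc (2 * P) X c ⟨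
  2 * P + X + c   ≡⟨ cong (_+ c) hS ⟩
  S + c           ≡⟨ hR ⟩
  R + X           ∎)
  where open ≡-Reasoning

module Consecutive (a : ℕ) where
  open Starlike a (suc a) (suc (suc a)) public

  K : ℕ
  K = 3 * a * a + 5 * a + 2

  -- In each branch the transmission is
  -- the own-branch sum plus two cross sums (reordered into that shape first),
  -- and the closed forms of these sums combine by a polynomial identity.
  weight-formula : ∀ {p} → Valid p → 2 * posTr p + 2 * suc a ≡ K + 2 * weight a p
  weight-formula {b₁ , r} r< = cancel-offset (posTr (b₁ , r))
    (transmission-parts _ O C C′ refl
       (withinSum-closed a r r<) (acrossSum-closed (suc a) r) (acrossSum-closed (suc (suc a)) r))
    (identity a r)
    where
      O C C′ : ℕ
      O  = withinSum a r
      C  = acrossSum (suc a) r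
      C′ = acrossSum (suc (suc a)) r
      identity : ∀ a r →
        a * suc a + 2 * (suc r * suc r)
          + (suc a * suc (suc a) + 2 * (suc a * r) + (suc (suc a) * suc (suc (suc a)) + 2 * (suc (suc a) * r)))
          + 2 * suc a
        ≡ 3 * a * a + 5 * a + 2 + 2 * (0 + suc (suc r) * (suc (suc r) + a)) + 2 * (suc a * suc r)
      identity = solve-∀
  weight-formula {b₂ , r} r< = cancel-offset (posTr (b₂ , r))
    (transmission-parts _ O C C′ (swap C O C′)
       (withinSum-closed (suc a) r r<) (acrossSum-closed a r) (acrossSum-closed (suc (suc a)) r))
    (identity a r)
    where
      O C C′ : ℕ
      O  = withinSum (suc a) r
      C  = acrossSum a r
      C′ = acrossSum (suc (suc a)) r
      swap : ∀ x y z → x + (y + z) ≡ y + (x + z)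
      swap = solve-∀
      identity : ∀ a r →
        suc a * suc (suc a) + 2 * (suc r * suc r)
          + (a * suc a + 2 * (a * r) + (suc (suc a) * suc (suc (suc a)) + 2 * (suc (suc a) * r)))
          + 2 * suc a
        ≡ 3 * a * a + 5 * a + 2 + 2 * ((2 + a) + suc r * (suc r + a)) + 2 * (suc (suc a) * suc r)
      identity = solve-∀
  weight-formula {b₃ , r} r< = cancel-offset (posTr (b₃ , r))
    (transmission-parts _ O C C′ (rotate C C′ O)
       (withinSum-closed (suc (suc a)) r r<) (acrossSum-closed a r) (acrossSum-closed (suc a) r))
    (identity a r)
    where
      O C C′ : ℕ
      O  = withinSum (suc (suc a)) r
      C  = acrossSum a r
      C′ = acrossSum (suc a) r
      rotate : ∀ x y z → x + (y + z) ≡ z + (x + y)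
      rotate = solve-∀
      identity : ∀ a r →
        suc (suc a) * suc (suc (suc a)) + 2 * (suc r * suc r)
          + (a * suc a + 2 * (a * r) + (suc a * suc (suc a) + 2 * (suc a * r)))
          + 2 * suc a
        ≡ 3 * a * a + 5 * a + 2 + 2 * ((2 + a + a) + r * (r + a)) + 2 * (suc (suc (suc a)) * suc r)
      identity = solve-∀

  doubled-Tr : ∀ v → 2 * Tr L v + 2 * suc a ≡ K + 2 * weight a (pos v)
  doubled-Tr v = trans (cong (λ t → 2 * t + 2 * suc a) (Tr≡posTr v)) (weight-formula (pos-valid v))

  Tr⇒weight : ∀ u v → Tr L u ≡ Tr L v → weight a (pos u) ≡ weight a (pos v)
  Tr⇒weight u v eq = *-cancelˡ-≡ _ _ 2 (+-cancelˡ-≡ K _ _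
    (trans (sym (doubled-Tr u)) (trans (cong (λ t → 2 * t + 2 * suc a) eq) (doubled-Tr v))))

  weight⇒Tr : ∀ u v → weight a (pos u) ≡ weight a (pos v) → Tr L u ≡ Tr L v
  weight⇒Tr u v eq = *-cancelˡ-≡ _ _ 2 (+-cancelʳ-≡ (2 * suc a) _ _
    (trans (doubled-Tr u) (trans (cong (λ w → K + 2 * w) eq) (sym (doubled-Tr v)))))

  even⇒irregular : 2 ∣ a → 0 < a → TransmissionIrregular L
  even⇒irregular (divides c even) a>0 u v eq =
    pos-injective (weight-injective a c even a>0 (Tr⇒weight u v eq))

  half<odd : ∀ c → a ≡ suc (c * 2) → c < a
  half<odd c odd = subst (c <_) (sym odd) (s≤s (m≤m*n c 2))

  odd⇒¬irregular : ∀ c → a ≡ suc (c * 2) → ¬ TransmissionIrregular L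
  odd⇒¬irregular c odd irregular
    with vertexAt {b₁ , c} (half<odd c odd) | vertexAt {b₃ , suc c} (s≤s (s≤s (<⇒≤ (half<odd c odd))))
  ... | u , pu | v , pv = b₁≢b₃ (cong proj₁ (trans (sym pu) (trans (cong pos u≡v) pv)))
    where
      collision : weight a (b₁ , c) ≡ weight a (b₃ , suc c)
      collision = subst (λ a → weight a (b₁ , c) ≡ weight a (b₃ , suc c)) (sym odd) (odd-collision c)
      u≡v : u ≡ v
      u≡v = irregular u v (weight⇒Tr u v
              (trans (cong (weight a) pu) (trans collision (cong (weight a) (sym pv)))))
      b₁≢b₃ : b₁ ≢ b₃
      b₁≢b₃ ()

theorem4p2 : (a : ℕ) → 2 ≤ a →
    (TransmissionIrregular (lineStarlike a (suc a) (suc (suc a))) ⇔ 2 ∣ a)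
theorem4p2 a 2≤a = mk⇔ irregular⇒even (λ 2∣a → even⇒irregular 2∣a (≤-trans (s≤s z≤n) 2≤a))
  where
    open Consecutive a
    irregular⇒even : TransmissionIrregular L → 2 ∣ a
    irregular⇒even irregular with even-or-odd a
    ... | inj₁ 2∣a       = 2∣a
    ... | inj₂ (c , odd) = contradiction irregular (odd⇒¬irregular c odd)
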